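{- Let $K$ be a finite set, $\phi\in L[K]$ and $\lambda,\nu\in\mathcal S^\phi$ with $\lambda\preceq\nu$. Then the Möbius function of the poset $(\mathcal S^\phi,\preceq)$ satisfies $$\mathrm{mb}_\preceq(\lambda,\nu)=\begin{cases}(-1)^{|\nu|-|\lambda|}&\text{if }\lambda\preceq\nu\text{ is minimal},\\0&\text{otherwise.}\end{cases}$$
   Context: For a finite set $K$, $L[K]$ is the set of linear orders on $K$; an order $\phi$ is identified with the word listing $K$ in increasing order ($i\prec_\phi j$: $i$ before $j$); $\phi|_J$ is restriction to $J$. For $\phi\in L[K]$, a set partition w.r.t. $\phi$ is a set $\lambda$ of arcs $i\frown j$ ($i,j\in K$) with $i\frown j\in\lambda\Rightarrow i\prec_\phi j$ and, for $i\frown l,j\frown k\in\lambda$, $i=j$ iff $k=l$; $\mathcal S^\phi$ is the set of these; $|\lambda|$ is the number of arcs; $\lambda_J=\{i\frown j\in\lambda:i,j\in J\}$. $(\phi,\lambda)$ is atomic if there is no decomposition $K=A\sqcup B$ with $A,B$ nonempty, $\phi=\phi|_A\phi|_B$ (concatenation) and $\lambda=\lambda_A\cup\lambda_B$. Every $\lambda\in\mathcal S^\phi$ has a unique factorization into atomics: $\phi=\phi|_{K_1}\cdots\phi|_{K_r}$ with $K_1,\dots,K_r$ consecutive segments of $\phi$, $\lambda=\bigcup_i\lambda_{K_i}$, each $(\phi|_{K_i},\lambda_{K_i})$ atomic; the $K_i$ are the atomics of $\lambda$. Define a relation $\lambda\lessdot\mu$ on $\mathcal S^\phi$ if $\mu=\lambda\cup\{i\frown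 j\}\in\mathcal S^\phi$ where $i$ and $j$ lie in different atomics of $\lambda$, and let $\preceq$ be its reflexive-transitive closure (a partial order on $\mathcal S^\phi$). For $\lambda\preceq\nu$, the relation is called minimal if for every subset $\mathcal B\subseteq\nu\setminus\lambda$ one has $\lambda\cup\mathcal B\preceq\nu$. $\mathrm{mb}_\preceq$ is the Möbius function of $(\mathcal S^\phi,\preceq)$. -}

module Defs where

open import Data.Nat as ℕ using (ℕ; zero; suc; _<_; _≤_; _∸_)
open import Data.Integer as ℤ using (ℤ; 0ℤ; 1ℤ; -1ℤ)
open import Data.Bool using (Bool; true; false; _∨_; if_then_else_)
open import Data.Fin using (Fin; toℕ)
open import Data.Fin.Permutation using (Permutation′; _⟨$⟩ʳ_)
open import Data.Vec using (Vec; []; _∷_; lookup; zipWith; _[_]%=_; _[_]≔_)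
open import Data.List using (List; foldr; map)
open import Data.List.Membership.Propositional using (_∈_)
open import Data.List.Relation.Unary.Unique.Propositional using (Unique)
open import Data.Product using (Σ; ∃; _×_; _,_)
open import Data.Sum using (_⊎_)
open import Relation.Nullary using (¬_)
open import Relation.Binary.PropositionalEquality using (_≡_; _≢_)
open import Relation.Binary.Construct.Closure.ReflexiveTransitive using (Star)

-- K is (up to relabelling) Fin n.  A linear order φ ∈ L[K] is given by a
-- bijection  φ : Fin n ↔ Fin n  sending an element to its position in the
-- word φ; so  i ≺_φ j  iff  pos φ i < pos φ j.

pos : {n : ℕ} → Permutation′ n → Fin n → ℕ
pos φ i = toℕ (φ ⟨$⟩ʳ i)

_≺[_]_ : {n : ℕ} → Fin n → Permutation′ n → Fin n → Set
i ≺[ φ ] j = pos φ i < pos φ j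

-- Sets of arcs on K: an n×n Boolean matrix; entry (i,j) true means the
-- arc i ⌢ j belongs to the set.

Arcs : ℕ → Set
Arcs n = Vec (Vec Bool n) n

Arc : {n : ℕ} → Arcs n → Fin n → Fin n → Set
Arc lam i j = lookup (lookup lam i) j ≡ true

_∪ᵃ_ : {n : ℕ} → Arcs n → Arcs n → Arcs n
a ∪ᵃ b = zipWith (zipWith _∨_) a b

addArc : {n : ℕ} → Arcs n → Fin n → Fin n → Arcs n
addArc lam i j = lam [ i ]%= (λ row → row [ j ]≔ true)

countRow : {m : ℕ} → Vec Bool m → ℕ
countRow [] = 0
countRow (true ∷ r) = suc (countRow r)
countRow (false ∷ r) = countRow r

sizeRows : {k n : ℕ} → Vec (Vec Bool n) k → ℕ
sizeRows [] = 0
sizeRows (r ∷ rs) = countRow r ℕ.+ sizeRows rs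

size : {n : ℕ} → Arcs n → ℕ
size = sizeRows

IsSetPartition : {n : ℕ} → Permutation′ n → Arcs n → Set
IsSetPartition {n} φ lam =
  (∀ (i j : Fin n) → Arc lam i j → i ≺[ φ ] j) ×
  (∀ (i l j k : Fin n) → Arc lam i l → Arc lam j k →
     (i ≡ j → k ≡ l) × (k ≡ l → i ≡ j))

-- A decomposition K = A ⊔ B with φ = φ|_A φ|_B is determined by the length
-- p of the prefix A (A = first p letters of φ); λ = λ_A ∪ λ_B means that no
-- arc of λ joins A and B.

SplitsAt : {n : ℕ} → Permutation′ n → Arcs n → ℕ → Set
SplitsAt {n} φ lam p =
  ∀ (a b : Fin n) → Arc lam a b →
    ¬ ((pos φ a < p × p ≤ pos φ b) ⊎ (pos φ b < p × p ≤ pos φ a))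

-- The atomics of λ are the maximal segments of φ containing no such
-- splitting point in their interior; hence i and j lie in different
-- atomics of λ iff some splitting point separates them.
DifferentAtomics : {n : ℕ} → Permutation′ n → Arcs n → Fin n → Fin n → Set
DifferentAtomics φ lam i j =
  ∃ λ (p : ℕ) → SplitsAt φ lam p ×
    ((pos φ i < p × p ≤ pos φ j) ⊎ (pos φ j < p × p ≤ pos φ i))

Cov : {n : ℕ} → Permutation′ n → Arcs n → Arcs n → Set
Cov {n} φ lam mu =
  IsSetPartition φ lam ×
  Σ (Fin n) λ i → Σ (Fin n) λ j →
    (mu ≡ addArc lam i j) × IsSetPartition φ mu × DifferentAtomics φ lam i j

Leq : {n : ℕ} → Permutation′ n → Arcs n → Arcs n → Set
Leq φ = Star (Cov φ)

IsMinimal : {n : ℕ} → Permutation′ n → Arcs n → Arcs n → Set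
IsMinimal {n} φ lam nu =
  ∀ (B : Arcs n) →
    (∀ (i j : Fin n) → Arc B i j → Arc nu i j × ¬ Arc lam i j) →
    Leq φ (lam ∪ᵃ B) nu

sumℤ : List ℤ → ℤ
sumℤ = foldr ℤ._+_ 0ℤ

-- "Σ_{z : P z} f z = s" for a finite predicate P: some duplicate-free list
-- enumerates exactly the z with P z, and the sum of f over it is s.
SumOver : {A : Set} → (A → Set) → (A → ℤ) → ℤ → Set
SumOver {A} P f s =
  Σ (List A) λ L → Unique L × (∀ z → (z ∈ L → P z) × (P z → z ∈ L)) ×
    (sumℤ (map f L) ≡ s)

IsMobius : {n : ℕ} → Permutation′ n → (Arcs n → Arcs n → ℤ) → Set
IsMobius {n} φ m =
  ∀ (x y : Arcs n) → IsSetPartition φ x → Leq φ x y →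
    (x ≡ y → m x y ≡ 1ℤ) ×
    (x ≢ y → SumOver (λ z → Leq φ x z × Leq φ z y) (m x) 0ℤ)

signPow : ℕ → ℤ
signPow zero = 1ℤ
signPow (suc k) = -1ℤ ℤ.* signPow k

-- Call z independent over x if x ⊆ z and every arc of z outside x can be deleted from z by
-- undoing one covering step.  For z ∈ S^φ this is a decidable reformulation of minimality of
-- x ⪯ z, and it already forces x ⪯ z.  The Möbius function is μ(x, z) = (-1)^{|z|-|x|} if z is
-- independent over x and 0 otherwise.  To get Σ_{x ⪯ z ⪯ y} μ(x, z) = δ(x, y), pick an arc e of
-- y outside x that is removable from y: the terms with e ∉ z add up to the same sum for
-- (x, y - e), those with e ∈ z to minus the sum for (x + e, y), and δ(x, y - e) = δ(x + e, y).
-- If y has no such arc and x ≠ y, no z contributes, since the arc added by the last covering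
-- step into y would be one.  Möbius functions are unique, by induction on |y| - |x|.
module Submission where

open import Defs
open import Data.Nat as ℕ using (ℕ; zero; suc; _<_; _≤_; _∸_; z≤n; s≤s; _<?_; _≤?_)
open import Data.Nat.Properties
  using (≤-reflexive; +-suc; <-≤-trans; ≤-<-trans; m≤n⇒m≤1+n; +-mono-≤; +-∸-assoc; n∸n≡0;
         ∸-monoˡ-<; ∸-monoʳ-<; anyUpTo?)
open import Data.Nat.Induction using (<-wellFounded)
open import Data.Integer using (ℤ; 0ℤ; 1ℤ; _+_; _-_; -_)
open import Data.Integer.Properties
  using (+-identityˡ; +-identityʳ; +-inverseʳ; neg-distrib-+; -1*i≡-i; i-j≡0⇒i≡j; +-0-commutativeMonoid;
         +-commutativeSemigroup)
open import Algebra.Bundles using (CommutativeMonoid)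
open import Algebra.Properties.CommutativeSemigroup +-commutativeSemigroup using (interchange)
open import Data.Bool using (Bool; true; false; _∨_; _∧_; not)
open import Data.Bool.Properties using (¬-not) renaming (_≟_ to _≟ᵇ_)
open import Data.Fin using (Fin; zero; suc)
open import Data.Fin.Properties using (any?; all?; toℕ<n) renaming (_≟_ to _≟ᶠ_)
open import Data.Fin.Permutation using (Permutation′)
open import Data.Vec using (Vec; []; _∷_; lookup; zipWith; updateAt; _[_]≔_)
open import Data.Vec.Properties
  using (tabulate∘lookup; tabulate-cong; lookup∘updateAt; lookup∘updateAt′; lookup-zipWith; ≡-dec;
         ∷-injectiveˡ; ∷-injectiveʳ)
open import Data.List using (List; []; _∷_; map; filter; cartesianProductWith)
open import Data.List.Membership.Propositional using (_∈_)
open import Data.List.Membership.Propositional.Properties using (∈-cartesianProductWith⁺; ∈-filter⁺; ∈-filter⁻)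
open import Data.List.Membership.Propositional.Properties.WithK using (unique∧set⇒bag)
open import Data.List.Relation.Binary.BagAndSetEquality using (∼bag⇒↭)
open import Data.List.Relation.Binary.Permutation.Propositional using (_↭_; ↭⇒↭ₛ)
import Data.List.Relation.Binary.Permutation.Propositional.Properties as ↭
open import Data.List.Relation.Binary.Permutation.Setoid.Properties using (foldr-commMonoid)
open import Data.List.Relation.Unary.All as All using ([]; _∷_)
open import Data.List.Relation.Unary.AllPairs using ([]; _∷_)
open import Data.List.Relation.Unary.Any using (here; there)
open import Data.List.Relation.Unary.Unique.Propositional using (Unique)
open import Data.List.Relation.Unary.Unique.Propositional.Properties using (cartesianProductWith⁺; filter⁺)
open import Data.Product using (Σ; ∃; _×_; _,_; proj₁; proj₂; uncurry; map₁)
open import Data.Sum using (_⊎_; inj₁; inj₂; [_,_]′)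
open import Data.Empty using (⊥-elim)
open import Function using (_∘_; _⇔_; mk⇔)
import Induction.WellFounded as WF
open import Relation.Binary.Construct.On as On using ()
open import Relation.Binary.Construct.Closure.ReflexiveTransitive using (ε; _◅_; _◅◅_)
open import Relation.Binary.PropositionalEquality using (_≡_; _≢_; refl; sym; trans; cong; cong₂; subst; module ≡-Reasoning)
open import Relation.Nullary using (¬_; Dec; yes; no)
open import Relation.Nullary.Decidable using (_×-dec_; _⊎-dec_; _→-dec_; ¬?; map′; decidable-stable)

ifYes : {P : Set} → Dec P → ℤ → ℤ
ifYes (yes _) c = c
ifYes (no _)  _ = 0ℤ

ifYes-yes : {P : Set} (p? : Dec P) {c : ℤ} → P → ifYes p? c ≡ c
ifYes-yes (yes _) _  = refl
ifYes-yes (no ¬p) p = ⊥-elim (¬p p)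

ifYes-no : {P : Set} (p? : Dec P) {c : ℤ} → ¬ P → ifYes p? c ≡ 0ℤ
ifYes-no (yes p) ¬p = ⊥-elim (¬p p)
ifYes-no (no _)  _  = refl

ifYes-cong : {P Q : Set} (p? : Dec P) (q? : Dec Q) {c d : ℤ} →
             (P → Q) → (Q → P) → (P → c ≡ d) → ifYes p? c ≡ ifYes q? d
ifYes-cong (yes p) (yes _) _ _ c≡d = c≡d p
ifYes-cong (yes p) (no ¬q) P⇒Q _ _ = ⊥-elim (¬q (P⇒Q p))
ifYes-cong (no ¬p) (yes q) _ Q⇒P _ = ⊥-elim (¬p (Q⇒P q))
ifYes-cong (no _)  (no _)  _ _ _   = refl

ifYes-neg : {P : Set} (p? : Dec P) (c : ℤ) → ifYes p? (- c) ≡ - ifYes p? c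
ifYes-neg (yes _) _ = refl
ifYes-neg (no _)  _ = refl

ifYes-ifYes : {P Q R : Set} (p? : Dec P) (q? : Dec Q) (r? : Dec R) {c : ℤ} →
              (P × Q → R) → (R → P × Q) → ifYes p? (ifYes q? c) ≡ ifYes r? c
ifYes-ifYes (yes p) (yes q) r? to _    = sym (ifYes-yes r? (to (p , q)))
ifYes-ifYes (yes _) (no ¬q) r? _  from = sym (ifYes-no r? (¬q ∘ proj₂ ∘ from))
ifYes-ifYes (no ¬p) _       r? _  from = sym (ifYes-no r? (¬p ∘ proj₁ ∘ from))

-- Sums over lists

sumOver : {A : Set} → List A → (A → ℤ) → ℤ
sumOver L f = sumℤ (map f L)

module _ {A : Set} where

  sumOver-cong : (L : List A) {f g : A → ℤ} → (∀ z → z ∈ L → f z ≡ g z) → sumOver L f ≡ sumOver L g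
  sumOver-cong []      _   = refl
  sumOver-cong (a ∷ L) f≡g = cong₂ _+_ (f≡g a (here refl)) (sumOver-cong L (λ z → f≡g z ∘ there))

  sumOver-zero : (L : List A) {f : A → ℤ} → (∀ z → z ∈ L → f z ≡ 0ℤ) → sumOver L f ≡ 0ℤ
  sumOver-zero []      _  = refl
  sumOver-zero (a ∷ L) f≡0 = cong₂ _+_ (f≡0 a (here refl)) (sumOver-zero L (λ z → f≡0 z ∘ there))

  sumOver-− : (L : List A) (f g : A → ℤ) → sumOver L (λ z → f z - g z) ≡ sumOver L f - sumOver L g
  sumOver-− []      _ _ = refl
  sumOver-− (a ∷ L) f g = trans (cong ((f a - g a) +_) (sumOver-− L f g))
    (trans (interchange (f a) (- g a) (sumOver L f) (- sumOver L g))
           (cong (f a + sumOver L f +_) (sym (neg-distrib-+ (g a) (sumOver L g)))))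

  sumOver-single : (L : List A) {f : A → ℤ} {y : A} → Unique L → y ∈ L →
                   (∀ z → z ∈ L → z ≢ y → f z ≡ 0ℤ) → sumOver L f ≡ f y
  sumOver-single (a ∷ L) {f} (a∉L ∷ _) (here refl) f≡0 =
    trans (cong (f a +_) (sumOver-zero L (λ z z∈L → f≡0 z (there z∈L) (λ { refl → All.lookup a∉L z∈L refl }))))
          (+-identityʳ _)
  sumOver-single (a ∷ L) (a∉L ∷ uL) (there y∈L) f≡0 =
    trans (cong₂ _+_ (f≡0 a (here refl) (All.lookup a∉L y∈L)) (sumOver-single L uL y∈L (λ z → f≡0 z ∘ there)))
          (+-identityˡ _)

  sumOver-↭ : {L M : List A} (f : A → ℤ) → L ↭ M → sumOver L f ≡ sumOver M f
  sumOver-↭ f L↭M = foldr-commMonoid setoid isCommutativeMonoid (↭⇒↭ₛ (↭.map⁺ f L↭M))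
    where open CommutativeMonoid +-0-commutativeMonoid

  sumOver-sameMembers : {L M : List A} (f : A → ℤ) → Unique L → Unique M →
                        (∀ {z} → z ∈ L ⇔ z ∈ M) → sumOver L f ≡ sumOver M f
  sumOver-sameMembers f uL uM L≈M = sumOver-↭ f (∼bag⇒↭ (unique∧set⇒bag uL uM L≈M))

  sumOver-filter : {P : A → Set} (P? : ∀ z → Dec (P z)) (L : List A) (f : A → ℤ) →
                   sumOver (filter P? L) f ≡ sumOver L (λ z → ifYes (P? z) (f z))
  sumOver-filter P? []      f = refl
  sumOver-filter P? (a ∷ L) f with P? a
  ... | yes _ = cong (f a +_) (sumOver-filter P? L f)
  ... | no _  = trans (sumOver-filter P? L f) (sym (+-identityˡ _))

allVecs : {B : Set} → List B → (k : ℕ) → List (Vec B k)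
allVecs xs zero    = [] ∷ []
allVecs xs (suc k) = cartesianProductWith _∷_ xs (allVecs xs k)

∈-allVecs : {B : Set} {xs : List B} → (∀ b → b ∈ xs) → {k : ℕ} (v : Vec B k) → v ∈ allVecs xs k
∈-allVecs all∈ []      = here refl
∈-allVecs all∈ (b ∷ v) = ∈-cartesianProductWith⁺ _∷_ (all∈ b) (∈-allVecs all∈ v)

allVecs-unique : {B : Set} {xs : List B} → Unique xs → (k : ℕ) → Unique (allVecs xs k)
allVecs-unique uxs zero    = [] ∷ []
allVecs-unique uxs (suc k) =
  cartesianProductWith⁺ _∷_ (λ e → ∷-injectiveˡ e , ∷-injectiveʳ e) uxs (allVecs-unique uxs k)

-- Sets of arcs

lookup-ext : {A : Set} {k : ℕ} {u v : Vec A k} → (∀ i → lookup u i ≡ lookup v i) → u ≡ v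
lookup-ext {u = u} {v} u≗v = trans (sym (tabulate∘lookup u)) (trans (tabulate-cong u≗v) (tabulate∘lookup v))

module _ {n : ℕ} where

  entry : Arcs n → Fin n → Fin n → Bool
  entry a i j = lookup (lookup a i) j

  setEntry : Arcs n → Fin n → Fin n → Bool → Arcs n
  setEntry a i j v = updateAt a i (_[ j ]≔ v)

  removeArc : Arcs n → Fin n → Fin n → Arcs n
  removeArc a i j = setEntry a i j false

  _∖ᵃ_ : Arcs n → Arcs n → Arcs n
  a ∖ᵃ b = zipWith (zipWith (λ u v → u ∧ not v)) a b

  -- A record rather than a function type, so that the two sets can be inferred.
  record _⊆ᵃ_ (a b : Arcs n) : Set where
    constructor mk⊆ᵃ
    field ⊆ᵃ-arc : ∀ i j → Arc a i j → Arc b i j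
  open _⊆ᵃ_ public

  SameArc : Fin n → Fin n → Fin n → Fin n → Set
  SameArc k l i j = k ≡ i × l ≡ j

  sameArc? : ∀ k l i j → Dec (SameArc k l i j)
  sameArc? k l i j = (k ≟ᶠ i) ×-dec (l ≟ᶠ j)

  Arc? : ∀ a i j → Dec (Arc a i j)
  Arc? a i j = entry a i j ≟ᵇ true

  _≟ᵃ_ : (a b : Arcs n) → Dec (a ≡ b)
  _≟ᵃ_ = ≡-dec (≡-dec _≟ᵇ_)

  _⊆ᵃ?_ : ∀ a b → Dec (a ⊆ᵃ b)
  a ⊆ᵃ? b = map′ mk⊆ᵃ ⊆ᵃ-arc (all? λ i → all? λ j → Arc? a i j →-dec Arc? b i j)

  ⊆ᵃ-refl : {a : Arcs n} → a ⊆ᵃ a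
  ⊆ᵃ-refl = mk⊆ᵃ λ _ _ ij∈a → ij∈a

  ⊆ᵃ-trans : {a b c : Arcs n} → a ⊆ᵃ b → b ⊆ᵃ c → a ⊆ᵃ c
  ⊆ᵃ-trans a⊆b b⊆c = mk⊆ᵃ λ i j → ⊆ᵃ-arc b⊆c i j ∘ ⊆ᵃ-arc a⊆b i j

  ⊆ᵃ-antisym : {a b : Arcs n} → a ⊆ᵃ b → b ⊆ᵃ a → a ≡ b
  ⊆ᵃ-antisym a⊆b b⊆a = lookup-ext λ i → lookup-ext λ j → bool-ext (⊆ᵃ-arc a⊆b i j) (⊆ᵃ-arc b⊆a i j)
    where
    bool-ext : {u v : Bool} → (u ≡ true → v ≡ true) → (v ≡ true → u ≡ true) → u ≡ v
    bool-ext {true}  {true}  _   _   = refl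
    bool-ext {true}  {false} u⇒v _   = sym (u⇒v refl)
    bool-ext {false} {true}  _   v⇒u = v⇒u refl
    bool-ext {false} {false} _   _   = refl

  entry-setEntry : ∀ a i j v → entry (setEntry a i j v) i j ≡ v
  entry-setEntry a i j v = trans (cong (λ r → lookup r j) (lookup∘updateAt i a)) (lookup∘updateAt j (lookup a i))

  entry-setEntry-other : ∀ a i j v k l → ¬ SameArc k l i j → entry (setEntry a i j v) k l ≡ entry a k l
  entry-setEntry-other a i j v k l kl≢ij with k ≟ᶠ i
  ... | no k≢i   = cong (λ r → lookup r l) (lookup∘updateAt′ k i k≢i a)
  ... | yes refl = trans (cong (λ r → lookup r l) (lookup∘updateAt k a))
                         (lookup∘updateAt′ l j (λ l≡j → kl≢ij (refl , l≡j)) (lookup a k))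

  entry-zipWith : ∀ (f : Bool → Bool → Bool) a b i j →
                  entry (zipWith (zipWith f) a b) i j ≡ f (entry a i j) (entry b i j)
  entry-zipWith f a b i j =
    trans (cong (λ r → lookup r j) (lookup-zipWith (zipWith f) i a b)) (lookup-zipWith f j (lookup a i) (lookup b i))

  addArc-here : ∀ a i j → Arc (addArc a i j) i j
  addArc-here a i j = entry-setEntry a i j true

  ⊆-addArc : ∀ a i j → a ⊆ᵃ addArc a i j
  ⊆-addArc a i j = mk⊆ᵃ λ k l kl∈a → case kl∈a (sameArc? k l i j)
    where
    case : ∀ {k l} → Arc a k l → Dec (SameArc k l i j) → Arc (addArc a i j) k l
    case _    (yes (refl , refl)) = addArc-here a i j
    case kl∈a (no kl≢ij)          = trans (entry-setEntry-other a i j true _ _ kl≢ij) kl∈a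

  addArc⁻ : ∀ a i j k l → Arc (addArc a i j) k l → SameArc k l i j ⊎ Arc a k l
  addArc⁻ a i j k l kl∈ with sameArc? k l i j
  ... | yes kl≡ij = inj₁ kl≡ij
  ... | no kl≢ij  = inj₂ (trans (sym (entry-setEntry-other a i j true k l kl≢ij)) kl∈)

  removeArc-here : ∀ a i j → ¬ Arc (removeArc a i j) i j
  removeArc-here a i j ij∈ with trans (sym (entry-setEntry a i j false)) ij∈
  ... | ()

  removeArc-there : ∀ a i j k l → Arc a k l → ¬ SameArc k l i j → Arc (removeArc a i j) k l
  removeArc-there a i j k l kl∈a kl≢ij = trans (entry-setEntry-other a i j false k l kl≢ij) kl∈a

  removeArc-⊆ : ∀ a i j → removeArc a i j ⊆ᵃ a
  removeArc-⊆ a i j = mk⊆ᵃ λ k l kl∈ → case kl∈ (sameArc? k l i j)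
    where
    case : ∀ {k l} → Arc (removeArc a i j) k l → Dec (SameArc k l i j) → Arc a k l
    case kl∈ (yes (refl , refl)) = ⊥-elim (removeArc-here a i j kl∈)
    case kl∈ (no kl≢ij)          = trans (sym (entry-setEntry-other a i j false _ _ kl≢ij)) kl∈

  addArc-⊆ : ∀ {a b} i j → a ⊆ᵃ b → Arc b i j → addArc a i j ⊆ᵃ b
  addArc-⊆ {a} {b} i j a⊆b ij∈b = mk⊆ᵃ λ k l kl∈ → case (addArc⁻ a i j k l kl∈)
    where
    case : ∀ {k l} → SameArc k l i j ⊎ Arc a k l → Arc b k l
    case (inj₁ (refl , refl)) = ij∈b
    case (inj₂ kl∈a)          = ⊆ᵃ-arc a⊆b _ _ kl∈a

  ⊆-removeArc : ∀ {a b} i j → a ⊆ᵃ b → ¬ Arc a i j → a ⊆ᵃ removeArc b i j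
  ⊆-removeArc {b = b} i j a⊆b ij∉a =
    mk⊆ᵃ λ k l kl∈a → removeArc-there b i j k l (⊆ᵃ-arc a⊆b k l kl∈a) λ { (refl , refl) → ij∉a kl∈a }

  removeArc-mono : ∀ {a b} i j → a ⊆ᵃ b → removeArc a i j ⊆ᵃ removeArc b i j
  removeArc-mono {a} i j a⊆b = ⊆-removeArc i j (⊆ᵃ-trans (removeArc-⊆ a i j) a⊆b) (removeArc-here a i j)

  addArc-removeArc : ∀ a i j → Arc a i j → addArc (removeArc a i j) i j ≡ a
  addArc-removeArc a i j ij∈a =
    ⊆ᵃ-antisym (addArc-⊆ i j (removeArc-⊆ a i j) ij∈a) (mk⊆ᵃ λ k l kl∈a → case kl∈a (sameArc? k l i j))
    where
    case : ∀ {k l} → Arc a k l → Dec (SameArc k l i j) → Arc (addArc (removeArc a i j) i j) k l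
    case _    (yes (refl , refl)) = addArc-here (removeArc a i j) i j
    case kl∈a (no kl≢ij)          = ⊆ᵃ-arc (⊆-addArc (removeArc a i j) i j) _ _ (removeArc-there a i j _ _ kl∈a kl≢ij)

  removeArc-addArc : ∀ a i j → ¬ Arc a i j → removeArc (addArc a i j) i j ≡ a
  removeArc-addArc a i j ij∉a = ⊆ᵃ-antisym (mk⊆ᵃ back) (⊆-removeArc i j (⊆-addArc a i j) ij∉a)
    where
    back : ∀ k l → Arc (removeArc (addArc a i j) i j) k l → Arc a k l
    back k l kl∈ with addArc⁻ a i j k l (⊆ᵃ-arc (removeArc-⊆ (addArc a i j) i j) k l kl∈)
    ... | inj₁ (refl , refl) = ⊥-elim (removeArc-here (addArc a i j) i j kl∈)
    ... | inj₂ kl∈a          = kl∈a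

  removeArc-addArc-comm : ∀ a i j k l → ¬ SameArc k l i j →
                          removeArc (addArc a k l) i j ≡ addArc (removeArc a i j) k l
  removeArc-addArc-comm a i j k l kl≢ij = ⊆ᵃ-antisym (mk⊆ᵃ to) from
    where
    to : ∀ c d → Arc (removeArc (addArc a k l) i j) c d → Arc (addArc (removeArc a i j) k l) c d
    to c d cd∈ with addArc⁻ a k l c d (⊆ᵃ-arc (removeArc-⊆ (addArc a k l) i j) c d cd∈)
    ... | inj₁ (refl , refl) = addArc-here (removeArc a i j) k l
    ... | inj₂ cd∈a = ⊆ᵃ-arc (⊆-addArc (removeArc a i j) k l) c d
                        (removeArc-there a i j c d cd∈a λ { (refl , refl) → removeArc-here (addArc a k l) i j cd∈ })
    from : addArc (removeArc a i j) k l ⊆ᵃ removeArc (addArc a k l) i j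
    from = addArc-⊆ k l (removeArc-mono i j (⊆-addArc a k l))
                        (removeArc-there (addArc a k l) i j k l (addArc-here a k l) kl≢ij)

  ∪ᵃ⁻ : ∀ a b i j → Arc (a ∪ᵃ b) i j → Arc a i j ⊎ Arc b i j
  ∪ᵃ⁻ a b i j ij∈ = lemma (trans (sym (entry-zipWith _∨_ a b i j)) ij∈)
    where
    lemma : ∀ {u v} → (u ∨ v) ≡ true → u ≡ true ⊎ v ≡ true
    lemma {true}  _ = inj₁ refl
    lemma {false} v = inj₂ v

  ⊆-∪ᵃˡ : ∀ a b → a ⊆ᵃ (a ∪ᵃ b)
  ⊆-∪ᵃˡ a b = mk⊆ᵃ λ i j ij∈a → trans (entry-zipWith _∨_ a b i j) (cong (_∨ entry b i j) ij∈a)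

  ⊆-∪ᵃʳ : ∀ a b → b ⊆ᵃ (a ∪ᵃ b)
  ⊆-∪ᵃʳ a b = mk⊆ᵃ λ i j ij∈b → trans (entry-zipWith _∨_ a b i j) (lemma ij∈b)
    where
    lemma : ∀ {u v} → v ≡ true → (u ∨ v) ≡ true
    lemma {true}  _ = refl
    lemma {false} v = v

  ∪ᵃ-⊆ : ∀ {a b c} → a ⊆ᵃ c → b ⊆ᵃ c → (a ∪ᵃ b) ⊆ᵃ c
  ∪ᵃ-⊆ {a} {b} {c} a⊆c b⊆c = mk⊆ᵃ λ i j ij∈ → case (∪ᵃ⁻ a b i j ij∈)
    where
    case : ∀ {i j} → Arc a i j ⊎ Arc b i j → Arc c i j
    case (inj₁ ij∈a) = ⊆ᵃ-arc a⊆c _ _ ij∈a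
    case (inj₂ ij∈b) = ⊆ᵃ-arc b⊆c _ _ ij∈b

  ∖ᵃ⁻ : ∀ a b i j → Arc (a ∖ᵃ b) i j → Arc a i j × ¬ Arc b i j
  ∖ᵃ⁻ a b i j ij∈ = lemma (trans (sym (entry-zipWith _ a b i j)) ij∈)
    where
    lemma : ∀ {u v} → (u ∧ not v) ≡ true → u ≡ true × ¬ v ≡ true
    lemma {true} {false} _ = refl , λ ()

  ∖ᵃ-⊆ : ∀ a b → (a ∖ᵃ b) ⊆ᵃ a
  ∖ᵃ-⊆ a b = mk⊆ᵃ λ i j → proj₁ ∘ ∖ᵃ⁻ a b i j

  ∖ᵃ⁺ : ∀ a b i j → Arc a i j → ¬ Arc b i j → Arc (a ∖ᵃ b) i j
  ∖ᵃ⁺ a b i j ij∈a ij∉b = trans (entry-zipWith _ a b i j) (lemma ij∈a ij∉b)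
    where
    lemma : ∀ {u v} → u ≡ true → ¬ v ≡ true → (u ∧ not v) ≡ true
    lemma {true} {true}  _ v≢t = ⊥-elim (v≢t refl)
    lemma {true} {false} _ _   = refl

countRow-setTrue : ∀ {m} (r : Vec Bool m) j → lookup r j ≡ false → countRow (r [ j ]≔ true) ≡ suc (countRow r)
countRow-setTrue (false ∷ r) zero    _    = refl
countRow-setTrue (true  ∷ r) (suc j) rj≡f = cong suc (countRow-setTrue r j rj≡f)
countRow-setTrue (false ∷ r) (suc j) rj≡f = countRow-setTrue r j rj≡f

sizeRows-updateAt : ∀ {k m} (rs : Vec (Vec Bool m) k) i (f : Vec Bool m → Vec Bool m) →
                    countRow (f (lookup rs i)) ≡ suc (countRow (lookup rs i)) →
                    sizeRows (updateAt rs i f) ≡ suc (sizeRows rs)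
sizeRows-updateAt (r ∷ rs) zero    f grows = cong (ℕ._+ sizeRows rs) grows
sizeRows-updateAt (r ∷ rs) (suc i) f grows =
  trans (cong (countRow r ℕ.+_) (sizeRows-updateAt rs i f grows)) (+-suc (countRow r) (sizeRows rs))

countRow-mono : ∀ {m} (r s : Vec Bool m) → (∀ j → lookup r j ≡ true → lookup s j ≡ true) → countRow r ≤ countRow s
countRow-mono []          []          _   = z≤n
countRow-mono (true  ∷ r) (true  ∷ s) r⊆s = s≤s (countRow-mono r s (r⊆s ∘ suc))
countRow-mono (true  ∷ r) (false ∷ s) r⊆s with r⊆s zero refl
... | ()
countRow-mono (false ∷ r) (true  ∷ s) r⊆s = m≤n⇒m≤1+n (countRow-mono r s (r⊆s ∘ suc))
countRow-mono (false ∷ r) (false ∷ s) r⊆s = countRow-mono r s (r⊆s ∘ suc)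

sizeRows-mono : ∀ {k m} (rs ss : Vec (Vec Bool m) k) →
                (∀ i j → lookup (lookup rs i) j ≡ true → lookup (lookup ss i) j ≡ true) → sizeRows rs ≤ sizeRows ss
sizeRows-mono []       []       _     = z≤n
sizeRows-mono (r ∷ rs) (s ∷ ss) rs⊆ss = +-mono-≤ (countRow-mono r s (rs⊆ss zero)) (sizeRows-mono rs ss (rs⊆ss ∘ suc))

module _ {n : ℕ} where

  size-mono : {a b : Arcs n} → a ⊆ᵃ b → size a ≤ size b
  size-mono {a} {b} a⊆b = sizeRows-mono a b (⊆ᵃ-arc a⊆b)

  size-addArc : ∀ a i j → ¬ Arc a i j → size (addArc {n} a i j) ≡ suc (size a)
  size-addArc a i j ij∉a = sizeRows-updateAt a i _ (countRow-setTrue (lookup a i) j (¬-not ij∉a))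

  size-removeArc : ∀ a i j → Arc a i j → size a ≡ suc (size (removeArc {n} a i j))
  size-removeArc a i j ij∈a = begin
    size a                                   ≡⟨ cong size (addArc-removeArc a i j ij∈a) ⟨
    size (addArc (removeArc a i j) i j)      ≡⟨ size-addArc (removeArc a i j) i j (removeArc-here a i j) ⟩
    suc (size (removeArc a i j))             ∎
    where open ≡-Reasoning

  allArcs : List (Arcs n)
  allArcs = allVecs (allVecs (true ∷ false ∷ []) n) n

  allArcs-unique : Unique allArcs
  allArcs-unique = allVecs-unique (allVecs-unique (((λ ()) ∷ []) ∷ [] ∷ []) n) n

  ∈-allArcs : ∀ a → a ∈ allArcs
  ∈-allArcs = ∈-allVecs (∈-allVecs λ { true → here refl ; false → there (here refl) })

  ⊂-witness : {a b : Arcs n} → a ⊆ᵃ b → a ≢ b → ∃ λ i → ∃ λ j → Arc b i j × ¬ Arc a i j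
  ⊂-witness {a} {b} a⊆b a≢b with any? (λ i → any? (λ j → Arc? b i j ×-dec ¬? (Arc? a i j)))
  ... | yes witness = witness
  ... | no ¬witness = ⊥-elim (a≢b (⊆ᵃ-antisym a⊆b (mk⊆ᵃ λ i j ij∈b → decidable-stable (Arc? a i j)
                                                      λ ij∉a → ¬witness (i , j , ij∈b , ij∉a))))

  δ : Arcs n → Arcs n → ℤ
  δ a b = ifYes (a ≟ᵃ b) 1ℤ

  δ-shift : ∀ a b i j → Arc b i j → ¬ Arc a i j → δ a (removeArc b i j) ≡ δ (addArc a i j) b
  δ-shift a b i j ij∈b ij∉a = ifYes-cong (a ≟ᵃ removeArc b i j) (addArc a i j ≟ᵃ b)
    (λ { refl → addArc-removeArc b i j ij∈b }) (λ { refl → sym (removeArc-addArc a i j ij∉a) }) (λ _ → refl)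

  sign : Arcs n → Arcs n → ℤ
  sign a b = signPow (size b ∸ size a)

  sign-refl : ∀ a → sign a a ≡ 1ℤ
  sign-refl a = cong signPow (n∸n≡0 (size a))

  sign-addArc : ∀ a i j {b} → ¬ Arc a i j → addArc a i j ⊆ᵃ b → sign a b ≡ - sign (addArc a i j) b
  sign-addArc a i j {b} ij∉a a+ij⊆b = begin
    signPow (size b ∸ size a)                      ≡⟨ cong signPow (+-∸-assoc 1 a<b) ⟩
    signPow (suc (size b ∸ suc (size a)))          ≡⟨ cong (λ s → signPow (suc (size b ∸ s))) (size-addArc a i j ij∉a) ⟨
    signPow (suc (size b ∸ size (addArc a i j)))   ≡⟨ -1*i≡-i _ ⟩
    - sign (addArc a i j) b                        ∎
    where
    open ≡-Reasoning
    a<b : size a < size b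
    a<b = subst (_≤ size b) (size-addArc a i j ij∉a) (size-mono a+ij⊆b)

  gap : Arcs n → Arcs n → ℕ
  gap a b = size b ∸ size a

  gap-rec : (P : Arcs n → Arcs n → Set) →
            (∀ a b → (∀ a′ b′ → gap a′ b′ < gap a b → P a′ b′) → P a b) → ∀ a b → P a b
  gap-rec P step a b =
    WF.All.wfRec (On.wellFounded (uncurry gap) <-wellFounded) _ (uncurry P)
              (λ (a , b) rec → step a b λ a′ b′ → rec {a′ , b′}) (a , b)

-- The poset (S^φ, ⪯)

module _ {n : ℕ} (φ : Permutation′ n) where

  Separates : Fin n → Fin n → ℕ → Set
  Separates i j p = (pos φ i < p × p ≤ pos φ j) ⊎ (pos φ j < p × p ≤ pos φ i)

  separates? : ∀ i j p → Dec (Separates i j p)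
  separates? i j p = ((pos φ i <? p) ×-dec (p ≤? pos φ j)) ⊎-dec ((pos φ j <? p) ×-dec (p ≤? pos φ i))

  separates⇒<n : ∀ {i j p} → Separates i j p → p < n
  separates⇒<n (inj₁ (_ , p≤j)) = ≤-<-trans p≤j (toℕ<n _)
  separates⇒<n (inj₂ (_ , p≤i)) = ≤-<-trans p≤i (toℕ<n _)

  isSetPartition? : ∀ a → Dec (IsSetPartition φ a)
  isSetPartition? a =
    (all? λ i → all? λ j → Arc? a i j →-dec (pos φ i <? pos φ j)) ×-dec
    (all? λ i → all? λ l → all? λ j → all? λ k → Arc? a i l →-dec (Arc? a j k →-dec
      (((i ≟ᶠ j) →-dec (k ≟ᶠ l)) ×-dec ((k ≟ᶠ l) →-dec (i ≟ᶠ j)))))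

  splitsAt? : ∀ a p → Dec (SplitsAt φ a p)
  splitsAt? a p = all? λ i → all? λ j → Arc? a i j →-dec ¬? (separates? i j p)

  differentAtomics? : ∀ a i j → Dec (DifferentAtomics φ a i j)
  differentAtomics? a i j =
    map′ (λ (p , _ , split) → p , split) (λ (p , split) → p , separates⇒<n (proj₂ split) , split)
         (anyUpTo? (λ p → splitsAt? a p ×-dec separates? i j p) n)

  cov? : ∀ a b → Dec (Cov φ a b)
  cov? a b = isSetPartition? a ×-dec
    any? λ i → any? λ j → (b ≟ᵃ addArc a i j) ×-dec (isSetPartition? b ×-dec differentAtomics? a i j)

  isSetPartition-⊆ : ∀ {a b} → a ⊆ᵃ b → IsSetPartition φ b → IsSetPartition φ a
  isSetPartition-⊆ a⊆b (ordered , matching) =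
    (λ i j → ordered i j ∘ ⊆ᵃ-arc a⊆b i j) ,
    (λ i l j k il∈a jk∈a → matching i l j k (⊆ᵃ-arc a⊆b i l il∈a) (⊆ᵃ-arc a⊆b j k jk∈a))

  differentAtomics-⊆ : ∀ {a b i j} → a ⊆ᵃ b → DifferentAtomics φ b i j → DifferentAtomics φ a i j
  differentAtomics-⊆ a⊆b (p , splits , sep) = p , (λ k l → splits k l ∘ ⊆ᵃ-arc a⊆b k l) , sep

  differentAtomics⇒∉ : ∀ {a i j} → DifferentAtomics φ a i j → ¬ Arc a i j
  differentAtomics⇒∉ {i = i} {j} (p , splits , sep) ij∈a = splits i j ij∈a sep

  cov⇒⊆ : ∀ {a b} → Cov φ a b → a ⊆ᵃ b
  cov⇒⊆ {a} (_ , i , j , refl , _) = ⊆-addArc a i j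

  cov⇒size : ∀ {a b} → Cov φ a b → size b ≡ suc (size a)
  cov⇒size {a} (_ , i , j , refl , _ , d) = size-addArc a i j (differentAtomics⇒∉ {a} d)

  leq⇒⊆ : ∀ {a b} → Leq φ a b → a ⊆ᵃ b
  leq⇒⊆ ε       = ⊆ᵃ-refl
  leq⇒⊆ (c ◅ l) = ⊆ᵃ-trans (cov⇒⊆ c) (leq⇒⊆ l)

  leq⇒size< : ∀ {a b} → Leq φ a b → a ≢ b → size a < size b
  leq⇒size< ε       a≢a = ⊥-elim (a≢a refl)
  leq⇒size< (c ◅ l) _   = <-≤-trans (≤-reflexive (sym (cov⇒size c))) (size-mono (leq⇒⊆ l))

  leq-isSetPartition : ∀ {a b} → Leq φ a b → IsSetPartition φ a → IsSetPartition φ b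
  leq-isSetPartition ε spa = spa
  leq-isSetPartition ((_ , _ , _ , _ , spb , _) ◅ l) _ = leq-isSetPartition l spb

  leq-first : ∀ {a b} → Leq φ a b → a ≢ b → ∃ λ i → ∃ λ j → Cov φ a (addArc a i j) × Leq φ (addArc a i j) b
  leq-first ε                              a≢a = ⊥-elim (a≢a refl)
  leq-first (c@(_ , i , j , refl , _) ◅ l) _   = i , j , c , l

  leq-last : ∀ {a b} → Leq φ a b → a ≡ b ⊎ ∃ λ w → Leq φ a w × Cov φ w b
  leq-last ε       = inj₁ refl
  leq-last (c ◅ l) with leq-last l
  ... | inj₁ refl           = inj₂ (_ , ε , c)
  ... | inj₂ (w , l′ , c′) = inj₂ (w , c ◅ l′ , c′)

  leq? : ∀ a b → Dec (Leq φ a b)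
  leq? = gap-rec (λ a b → Dec (Leq φ a b)) decide
    where
    decide : ∀ a b → (∀ a′ b′ → gap a′ b′ < gap a b → Dec (Leq φ a′ b′)) → Dec (Leq φ a b)
    decide a b rec with a ≟ᵃ b | size a <? size b
    ... | yes refl | _       = yes ε
    ... | no a≢b   | no a≮b  = no λ a⪯b → a≮b (leq⇒size< a⪯b a≢b)
    ... | no a≢b   | yes a<b =
      map′ (λ (_ , _ , c , l) → c ◅ l) (λ a⪯b → leq-first a⪯b a≢b) (any? λ i → any? λ j → firstStep? i j)
      where
      firstStep? : ∀ i j → Dec (Cov φ a (addArc a i j) × Leq φ (addArc a i j) b)
      firstStep? i j with cov? a (addArc a i j)
      ... | no ¬c = no (¬c ∘ proj₁)
      ... | yes c = map′ (c ,_) proj₂ (rec (addArc a i j) b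
                      (∸-monoʳ-< (≤-reflexive (sym (cov⇒size c))) (subst (_≤ size b) (sym (cov⇒size c)) a<b)))

  cov-removeArc : ∀ {u v} i j → Cov φ u v → Arc u i j → Cov φ (removeArc u i j) (removeArc v i j)
  cov-removeArc {u} i j (spu , k , l , refl , spv , d) ij∈u =
    isSetPartition-⊆ (removeArc-⊆ u i j) spu , k , l ,
    removeArc-addArc-comm u i j k l (λ { (refl , refl) → differentAtomics⇒∉ {u} d ij∈u }) ,
    isSetPartition-⊆ (removeArc-⊆ (addArc u k l) i j) spv ,
    differentAtomics-⊆ (removeArc-⊆ u i j) d

  leq-removeArc : ∀ {u v} i j → Leq φ u v → Arc u i j → Leq φ (removeArc u i j) (removeArc v i j)
  leq-removeArc i j ε       _    = ε
  leq-removeArc i j (c ◅ l) ij∈u = cov-removeArc i j c ij∈u ◅ leq-removeArc i j l (⊆ᵃ-arc (cov⇒⊆ c) i j ij∈u)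

  leq-removeArcʳ : ∀ {z y} i j → Leq φ z y → Arc y i j → ¬ Arc z i j → Leq φ z (removeArc y i j)
  leq-removeArcʳ i j ε ij∈y ij∉z = ⊥-elim (ij∉z ij∈y)
  leq-removeArcʳ {z} {y} i j (c@(_ , k , l , refl , _) ◅ z+kl⪯y) ij∈y ij∉z with sameArc? k l i j
  ... | yes (refl , refl) =
    subst (λ w → Leq φ w (removeArc y i j)) (removeArc-addArc z i j ij∉z) (leq-removeArc i j z+kl⪯y (addArc-here z i j))
  ... | no kl≢ij = c ◅ leq-removeArcʳ i j z+kl⪯y ij∈y ij∉z+kl
    where
    ij∉z+kl : ¬ Arc (addArc z k l) i j
    ij∉z+kl = [ (λ { (refl , refl) → kl≢ij (refl , refl) }) , ij∉z ]′ ∘ addArc⁻ z k l i j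

  -- Equivalently, z ∖ {i ⌢ j} ⋖ z.
  Removable : Arcs n → Fin n → Fin n → Set
  Removable z i j = DifferentAtomics φ (removeArc z i j) i j

  removable? : ∀ z i j → Dec (Removable z i j)
  removable? z i j = differentAtomics? (removeArc z i j) i j

  removable-⊆ : ∀ {w z} i j → w ⊆ᵃ z → Removable z i j → Removable w i j
  removable-⊆ i j w⊆z = differentAtomics-⊆ (removeArc-mono i j w⊆z)

  removable⇒cov : ∀ {z} i j → IsSetPartition φ z → Arc z i j → Removable z i j → Cov φ (removeArc z i j) z
  removable⇒cov {z} i j spz ij∈z removable =
    isSetPartition-⊆ (removeArc-⊆ z i j) spz , i , j , sym (addArc-removeArc z i j ij∈z) , spz , removable

  cov⇒removable : ∀ {w z} → Cov φ w z → ∃ λ i → ∃ λ j → Arc z i j × ¬ Arc w i j × Removable z i j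
  cov⇒removable {w} (_ , i , j , refl , _ , d) =
    i , j , addArc-here w i j , ij∉w , subst (λ v → DifferentAtomics φ v i j) (sym (removeArc-addArc w i j ij∉w)) d
    where
    ij∉w : ¬ Arc w i j
    ij∉w = differentAtomics⇒∉ {w} d

  leq-removeArc⇒removable : ∀ {z} i j → Leq φ (removeArc z i j) z → Arc z i j → Removable z i j
  leq-removeArc⇒removable {z} i j z-ij⪯z ij∈z = firstStep z-ij⪯z refl
    where
    firstStep : ∀ {w} → Leq φ w z → w ≡ removeArc z i j → Removable z i j
    firstStep ε z≡ = ⊥-elim (removeArc-here z i j (subst (λ v → Arc v i j) z≡ ij∈z))
    firstStep ((_ , k , l , refl , _ , d) ◅ w+kl⪯z) refl with sameArc? k l i j
    ... | yes (refl , refl) = d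
    ... | no kl≢ij = ⊥-elim (differentAtomics⇒∉ {removeArc z i j} d (removeArc-there z i j k l kl∈z kl≢ij))
      where
      kl∈z : Arc z k l
      kl∈z = ⊆ᵃ-arc (leq⇒⊆ w+kl⪯z) k l (addArc-here (removeArc z i j) k l)

  -- The decidable counterpart of IsMinimal φ x z.
  Independent : Arcs n → Arcs n → Set
  Independent x z = x ⊆ᵃ z × (∀ i j → Arc z i j → ¬ Arc x i j → Removable z i j)

  independent? : ∀ x z → Dec (Independent x z)
  independent? x z =
    (x ⊆ᵃ? z) ×-dec (all? λ i → all? λ j → Arc? z i j →-dec (¬? (Arc? x i j) →-dec removable? z i j))

  independent-refl : ∀ {x} → Independent x x
  independent-refl = ⊆ᵃ-refl , λ _ _ ij∈x ij∉x → ⊥-elim (ij∉x ij∈x)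

  independent-mono : ∀ {x x′ z} → x ⊆ᵃ x′ → x′ ⊆ᵃ z → Independent x z → Independent x′ z
  independent-mono x⊆x′ x′⊆z (_ , removable) =
    x′⊆z , λ i j ij∈z ij∉x′ → removable i j ij∈z (ij∉x′ ∘ ⊆ᵃ-arc x⊆x′ i j)

  independent-removeArc : ∀ {x z} i j → Independent x z → ¬ Arc x i j → Independent x (removeArc z i j)
  independent-removeArc {z = z} i j (x⊆z , removable) ij∉x =
    ⊆-removeArc i j x⊆z ij∉x ,
    λ k l kl∈ kl∉x → removable-⊆ k l (removeArc-⊆ z i j)
                                      (removable k l (⊆ᵃ-arc (removeArc-⊆ z i j) k l kl∈) kl∉x)

  independent⇒leq : ∀ {x z} → IsSetPartition φ z → Independent x z → Leq φ x z
  independent⇒leq {x} {z} = gap-rec Goal step x z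
    where
    Goal : Arcs n → Arcs n → Set
    Goal x z = IsSetPartition φ z → Independent x z → Leq φ x z
    step : ∀ x z → (∀ x′ z′ → gap x′ z′ < gap x z → Goal x′ z′) → Goal x z
    step x z rec spz ind with x ≟ᵃ z
    ... | yes refl = ε
    ... | no x≢z with ⊂-witness (proj₁ ind) x≢z
    ... | i , j , ij∈z , ij∉x =
      rec x (removeArc z i j) smaller (isSetPartition-⊆ (removeArc-⊆ z i j) spz) ind′ ◅◅
      (removable⇒cov i j spz ij∈z (proj₂ ind i j ij∈z ij∉x) ◅ ε)
      where
      ind′ : Independent x (removeArc z i j)
      ind′ = independent-removeArc i j ind ij∉x
      smaller : gap x (removeArc z i j) < gap x z
      smaller = ∸-monoˡ-< (≤-reflexive (sym (size-removeArc z i j ij∈z))) (size-mono (proj₁ ind′))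

  independent⇒minimal : ∀ {x z} → IsSetPartition φ z → Independent x z → IsMinimal φ x z
  independent⇒minimal {x} {z} spz ind B B⊆z∖x =
    independent⇒leq spz (independent-mono (⊆-∪ᵃˡ x B) (∪ᵃ-⊆ (proj₁ ind) B⊆z) ind)
    where
    B⊆z : B ⊆ᵃ z
    B⊆z = mk⊆ᵃ λ i j → proj₁ ∘ B⊆z∖x i j

  minimal⇒independent : ∀ {x z} → x ⊆ᵃ z → IsMinimal φ x z → Independent x z
  minimal⇒independent {x} {z} x⊆z minimal = x⊆z , λ i j ij∈z ij∉x →
    leq-removeArc⇒removable i j (subst (λ w → Leq φ w z) (x∪B≡ i j ij∉x) (minimal (B i j) B⊆z∖x)) ij∈z
    where
    B : Fin n → Fin n → Arcs n
    B i j = removeArc (z ∖ᵃ x) i j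
    B⊆z∖x : ∀ {i j} k l → Arc (B i j) k l → Arc z k l × ¬ Arc x k l
    B⊆z∖x {i} {j} k l = ∖ᵃ⁻ z x k l ∘ ⊆ᵃ-arc (removeArc-⊆ (z ∖ᵃ x) i j) k l
    x∪B≡ : ∀ i j → ¬ Arc x i j → x ∪ᵃ B i j ≡ removeArc z i j
    x∪B≡ i j ij∉x =
      ⊆ᵃ-antisym (∪ᵃ-⊆ (⊆-removeArc i j x⊆z ij∉x) (removeArc-mono i j (∖ᵃ-⊆ z x))) (mk⊆ᵃ back)
      where
      back : ∀ k l → Arc (removeArc z i j) k l → Arc (x ∪ᵃ B i j) k l
      back k l kl∈ with Arc? x k l
      ... | yes kl∈x = ⊆ᵃ-arc (⊆-∪ᵃˡ x (B i j)) k l kl∈x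
      ... | no kl∉x  = ⊆ᵃ-arc (⊆-∪ᵃʳ x (B i j)) k l
                         (removeArc-there (z ∖ᵃ x) i j k l (∖ᵃ⁺ z x k l (⊆ᵃ-arc (removeArc-⊆ z i j) k l kl∈) kl∉x)
                                          λ { (refl , refl) → removeArc-here z i j kl∈ })

  independent-addArc : ∀ {x z} i j → Independent x z → Arc z i j → Independent (addArc x i j) z
  independent-addArc {x} i j ind ij∈z = independent-mono (⊆-addArc x i j) (addArc-⊆ i j (proj₁ ind) ij∈z) ind

  independent-addArc⁻ : ∀ {x z} i j → Independent (addArc x i j) z → Removable z i j → Independent x z
  independent-addArc⁻ {x} {z} i j (x+ij⊆z , removable) ij-removable =
    ⊆ᵃ-trans (⊆-addArc x i j) x+ij⊆z , λ k l kl∈z kl∉x → case kl∈z kl∉x (sameArc? k l i j)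
    where
    case : ∀ {k l} → Arc z k l → ¬ Arc x k l → Dec (SameArc k l i j) → Removable z k l
    case _    _    (yes (refl , refl)) = ij-removable
    case kl∈z kl∉x (no kl≢ij)          = removable _ _ kl∈z ([ kl≢ij , kl∉x ]′ ∘ addArc⁻ x i j _ _)

  HasRemovable : Arcs n → Arcs n → Set
  HasRemovable x y = ∃ λ i → ∃ λ j → Arc y i j × ¬ Arc x i j × Removable y i j

  hasRemovable? : ∀ x y → Dec (HasRemovable x y)
  hasRemovable? x y = any? λ i → any? λ j → Arc? y i j ×-dec (¬? (Arc? x i j) ×-dec removable? y i j)

  hasRemovable-below : ∀ {x y z} → x ≢ y → Leq φ z y → Independent x z → HasRemovable x y
  hasRemovable-below {x} {y} x≢y z⪯y ind with leq-last z⪯y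
  ... | inj₁ refl with ⊂-witness (proj₁ ind) x≢y
  ...   | i , j , ij∈y , ij∉x = i , j , ij∈y , ij∉x , proj₂ ind i j ij∈y ij∉x
  hasRemovable-below {x} {y} x≢y z⪯y ind | inj₂ (w , z⪯w , c) with cov⇒removable c
  ...   | i , j , ij∈y , ij∉w , removable =
    i , j , ij∈y , ij∉w ∘ ⊆ᵃ-arc (⊆ᵃ-trans (proj₁ ind) (leq⇒⊆ z⪯w)) i j , removable

  termBelow : Arcs n → Arcs n → Arcs n → ℤ
  termBelow x y z = ifYes (leq? z y ×-dec independent? x z) (sign x z)

  sumBelow : Arcs n → Arcs n → ℤ
  sumBelow x y = sumOver allArcs (termBelow x y)

  sumBelow-refl : ∀ x → sumBelow x x ≡ 1ℤ
  sumBelow-refl x = trans (sumOver-single allArcs allArcs-unique (∈-allArcs x) vanish)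
                          (trans (ifYes-yes (leq? x x ×-dec independent? x x) (ε , independent-refl)) (sign-refl x))
    where
    vanish : ∀ z → z ∈ allArcs → z ≢ x → termBelow x x z ≡ 0ℤ
    vanish z _ z≢x = ifYes-no (leq? z x ×-dec independent? x z)
                              λ (z⪯x , ind) → z≢x (⊆ᵃ-antisym (leq⇒⊆ z⪯x) (proj₁ ind))

  sumBelow-noRemovable : ∀ {x y} → x ≢ y → ¬ HasRemovable x y → sumBelow x y ≡ 0ℤ
  sumBelow-noRemovable {x} {y} x≢y ¬removable = sumOver-zero allArcs λ z _ →
    ifYes-no (leq? z y ×-dec independent? x z) λ (z⪯y , ind) → ¬removable (hasRemovable-below x≢y z⪯y ind)

  termBelow-split : ∀ {x y} i j → IsSetPartition φ y → Arc y i j → ¬ Arc x i j → Removable y i j → ∀ z →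
                    termBelow x y z ≡ termBelow x (removeArc y i j) z - termBelow (addArc x i j) y z
  termBelow-split {x} {y} i j spy ij∈y ij∉x removable z = split (Arc? z i j)
    where
    open ≡-Reasoning
    y′ x′ : Arcs n
    y′ = removeArc y i j
    x′ = addArc x i j

    split : Dec (Arc z i j) → termBelow x y z ≡ termBelow x y′ z - termBelow x′ y z
    split (no ij∉z) = begin
      termBelow x y z                      ≡⟨ ifYes-cong (leq? z y ×-dec independent? x z) (leq? z y′ ×-dec independent? x z)
                                               (map₁ λ z⪯y → leq-removeArcʳ i j z⪯y ij∈y ij∉z)
                                               (map₁ λ z⪯y′ → z⪯y′ ◅◅ (removable⇒cov i j spy ij∈y removable ◅ ε))
                                               (λ _ → refl) ⟩
      termBelow x y′ z                     ≡⟨ +-identityʳ _ ⟨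
      termBelow x y′ z - 0ℤ                ≡⟨ cong (λ t → termBelow x y′ z - t) x′-absent ⟨
      termBelow x y′ z - termBelow x′ y z  ∎
      where
      x′-absent : termBelow x′ y z ≡ 0ℤ
      x′-absent = ifYes-no (leq? z y ×-dec independent? x′ z)
                           λ (_ , ind) → ij∉z (⊆ᵃ-arc (proj₁ ind) i j (addArc-here x i j))
    split (yes ij∈z) = begin
      termBelow x y z                      ≡⟨ ifYes-cong (leq? z y ×-dec independent? x z) (leq? z y ×-dec independent? x′ z)
                                               (λ (z⪯y , ind) → z⪯y , independent-addArc i j ind ij∈z)
                                               (λ (z⪯y , ind) → z⪯y , independent-addArc⁻ i j ind
                                                                         (removable-⊆ i j (leq⇒⊆ z⪯y) removable))
                                               (λ (_ , ind) → sign-addArc x i j ij∉x (addArc-⊆ i j (proj₁ ind) ij∈z)) ⟩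
      ifYes (leq? z y ×-dec independent? x′ z) (- sign x′ z)
                                           ≡⟨ ifYes-neg (leq? z y ×-dec independent? x′ z) (sign x′ z) ⟩
      - termBelow x′ y z                   ≡⟨ +-identityˡ _ ⟨
      0ℤ - termBelow x′ y z                ≡⟨ cong (λ t → t - termBelow x′ y z) y′-absent ⟨
      termBelow x y′ z - termBelow x′ y z  ∎
      where
      y′-absent : termBelow x y′ z ≡ 0ℤ
      y′-absent = ifYes-no (leq? z y′ ×-dec independent? x z)
                           λ (z⪯y′ , _) → removeArc-here y i j (⊆ᵃ-arc (leq⇒⊆ z⪯y′) i j ij∈z)

  sumBelow≡δ : ∀ x y → IsSetPartition φ y → x ⊆ᵃ y → sumBelow x y ≡ δ x y
  sumBelow≡δ = gap-rec Goal step
    where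
    Goal : Arcs n → Arcs n → Set
    Goal x y = IsSetPartition φ y → x ⊆ᵃ y → sumBelow x y ≡ δ x y
    step : ∀ x y → (∀ x′ y′ → gap x′ y′ < gap x y → Goal x′ y′) → Goal x y
    step x y rec spy x⊆y with x ≟ᵃ y
    ... | yes refl = sumBelow-refl x
    ... | no x≢y with hasRemovable? x y
    ...   | no ¬removable = sumBelow-noRemovable x≢y ¬removable
    ...   | yes (i , j , ij∈y , ij∉x , removable) = begin
      sumBelow x y                  ≡⟨ sumOver-cong allArcs (λ z _ → termBelow-split i j spy ij∈y ij∉x removable z) ⟩
      sumOver allArcs (λ z → termBelow x y′ z - termBelow x′ y z)
                                    ≡⟨ sumOver-− allArcs (termBelow x y′) (termBelow x′ y) ⟩
      sumBelow x y′ - sumBelow x′ y ≡⟨ cong₂ _-_ (rec x y′ y′-smaller spy′ x⊆y′) (rec x′ y x′-smaller spy x′⊆y) ⟩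
      δ x y′ - δ x′ y               ≡⟨ cong (λ t → δ x y′ - t) (δ-shift x y i j ij∈y ij∉x) ⟨
      δ x y′ - δ x y′               ≡⟨ +-inverseʳ (δ x y′) ⟩
      0ℤ                            ∎
      where
      open ≡-Reasoning
      y′ x′ : Arcs n
      y′ = removeArc y i j
      x′ = addArc x i j
      x⊆y′ : x ⊆ᵃ y′
      x⊆y′ = ⊆-removeArc i j x⊆y ij∉x
      x′⊆y : x′ ⊆ᵃ y
      x′⊆y = addArc-⊆ i j x⊆y ij∈y
      spy′ : IsSetPartition φ y′
      spy′ = isSetPartition-⊆ (removeArc-⊆ y i j) spy
      y′-smaller : gap x y′ < gap x y
      y′-smaller = ∸-monoˡ-< (≤-reflexive (sym (size-removeArc y i j ij∈y))) (size-mono x⊆y′)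
      x′-smaller : gap x′ y < gap x y
      x′-smaller = ∸-monoʳ-< (≤-reflexive (sym (size-addArc x i j ij∉x))) (size-mono x′⊆y)

  mobius : Arcs n → Arcs n → ℤ
  mobius x z = ifYes (independent? x z) (sign x z)

  mobius-isMobius : IsMobius φ mobius
  mobius-isMobius x y spx x⪯y = diagonal , vanishing
    where
    diagonal : x ≡ y → mobius x y ≡ 1ℤ
    diagonal refl = trans (ifYes-yes (independent? x x) independent-refl) (sign-refl x)

    interval? : ∀ z → Dec (Leq φ x z × Leq φ z y)
    interval? z = leq? x z ×-dec leq? z y

    spy : IsSetPartition φ y
    spy = leq-isSetPartition x⪯y spx

    vanishing : x ≢ y → SumOver (λ z → Leq φ x z × Leq φ z y) (mobius x) 0ℤ
    vanishing x≢y =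
      filter interval? allArcs , filter⁺ interval? allArcs-unique ,
      (λ z → proj₂ ∘ ∈-filter⁻ interval? {xs = allArcs} , ∈-filter⁺ interval? (∈-allArcs z)) ,
      (begin
        sumOver (filter interval? allArcs) (mobius x)              ≡⟨ sumOver-filter interval? allArcs (mobius x) ⟩
        sumOver allArcs (λ z → ifYes (interval? z) (mobius x z))   ≡⟨ sumOver-cong allArcs (λ z _ → below z) ⟩
        sumBelow x y                                               ≡⟨ sumBelow≡δ x y spy (leq⇒⊆ x⪯y) ⟩
        δ x y                                                      ≡⟨ ifYes-no (x ≟ᵃ y) x≢y ⟩
        0ℤ                                                         ∎)
      where
      open ≡-Reasoning
      below : ∀ z → ifYes (interval? z) (mobius x z) ≡ termBelow x y z
      below z = ifYes-ifYes (interval? z) (independent? x z) (leq? z y ×-dec independent? x z)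
        (λ ((_ , z⪯y) , ind) → z⪯y , ind)
        (λ (z⪯y , ind) → (independent⇒leq (isSetPartition-⊆ (leq⇒⊆ z⪯y) spy) ind , z⪯y) , ind)

  mobius-unique : ∀ {m m′} → IsMobius φ m → IsMobius φ m′ →
                  ∀ x y → IsSetPartition φ x → Leq φ x y → m x y ≡ m′ x y
  mobius-unique {m} {m′} isMobius isMobius′ = gap-rec Goal step
    where
    Goal : Arcs n → Arcs n → Set
    Goal x y = IsSetPartition φ x → Leq φ x y → m x y ≡ m′ x y
    step : ∀ x y → (∀ x′ y′ → gap x′ y′ < gap x y → Goal x′ y′) → Goal x y
    step x y rec spx x⪯y with x ≟ᵃ y
    ... | yes refl = trans (proj₁ (isMobius x x spx x⪯y) refl) (sym (proj₁ (isMobius′ x x spx x⪯y) refl))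
    ... | no x≢y with proj₂ (isMobius x y spx x⪯y) x≢y | proj₂ (isMobius′ x y spx x⪯y) x≢y
    ...   | L , uL , memL , ΣL≡0 | L′ , uL′ , memL′ , ΣL′≡0 = i-j≡0⇒i≡j (m x y) (m′ x y) (begin
      m x y - m′ x y                      ≡⟨ sumOver-single L {λ z → m x z - m′ x z} uL y∈L agree ⟨
      sumOver L (λ z → m x z - m′ x z)    ≡⟨ sumOver-− L (m x) (m′ x) ⟩
      sumOver L (m x) - sumOver L (m′ x)  ≡⟨ cong₂ _-_ ΣL≡0 ΣL[m′]≡0 ⟩
      0ℤ                                  ∎)
      where
      open ≡-Reasoning
      y∈L : y ∈ L
      y∈L = proj₂ (memL y) (x⪯y , ε)
      sameMembers : ∀ {z} → z ∈ L ⇔ z ∈ L′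
      sameMembers {z} = mk⇔ (proj₂ (memL′ z) ∘ proj₁ (memL z)) (proj₂ (memL z) ∘ proj₁ (memL′ z))
      ΣL[m′]≡0 : sumOver L (m′ x) ≡ 0ℤ
      ΣL[m′]≡0 = trans (sumOver-sameMembers (m′ x) uL uL′ sameMembers) ΣL′≡0
      agree : ∀ z → z ∈ L → z ≢ y → m x z - m′ x z ≡ 0ℤ
      agree z z∈L z≢y with proj₁ (memL z) z∈L
      ... | x⪯z , z⪯y = trans (cong (λ t → t - m′ x z) (rec x z smaller spx x⪯z)) (+-inverseʳ (m′ x z))
        where
        smaller : gap x z < gap x y
        smaller = ∸-monoˡ-< (leq⇒size< z⪯y z≢y) (size-mono (leq⇒⊆ x⪯z))

proposition5p2 : (n : ℕ) (φ : Permutation′ n) (lam nu : Arcs n) →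
    IsSetPartition φ lam → IsSetPartition φ nu → Leq φ lam nu →
    Σ (Arcs n → Arcs n → ℤ) (IsMobius φ) ×
    (∀ (mb : Arcs n → Arcs n → ℤ) → IsMobius φ mb →
    (IsMinimal φ lam nu → mb lam nu ≡ signPow (size nu ∸ size lam)) ×
    (¬ IsMinimal φ lam nu → mb lam nu ≡ 0ℤ))
proposition5p2 n φ lam nu splam spnu lam⪯nu = (mobius φ , mobius-isMobius φ) , λ mb isMobius →
  let mb≡mobius = mobius-unique φ isMobius (mobius-isMobius φ) lam nu splam lam⪯nu in
  (λ minimal → trans mb≡mobius
     (ifYes-yes (independent? φ lam nu) (minimal⇒independent φ (leq⇒⊆ φ lam⪯nu) minimal))) ,
  (λ ¬minimal → trans mb≡mobius
     (ifYes-no (independent? φ lam nu) (¬minimal ∘ independent⇒minimal φ spnu)))
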